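{- Let $q$ be a prime power. In $PG(3,q)$ there is no flock of a wide cone which is both a bilinear flock and a proper star flock.
   Context: In $PG(3,q)$ with coordinates $(x_0,x_1,x_2,x_3)$, let $V=(0,0,0,1)$ and $\pi_0$ the plane $x_3=0$. A flock is a set of $q$ distinct planes of the form $f(t)x_0+g(t)x_1+h(t)x_2-x_3=0$, $t\in GF(q)$, with $f(0)=g(0)=h(0)=0$. For a nonempty set $\mathcal{S}$ of points of $\pi_0$, the cone $\Sigma(V,\mathcal{S})$ is the union of the lines $VP$, $P\in\mathcal{S}$ ($\mathcal{S}$ is its carrier); a flock is a flock of this cone if no two distinct planes of the flock meet in a point of the cone. A star flock is a flock whose planes share a common point; it is proper if this common point is unique. A bilinear flock is a flock in which each plane contains at least one of two fixed distinct lines of $PG(3,q)$. For a nonempty set $S$ of points of a projective plane of order $q$ and a point $P$, $w_S(P)$ is the number of lines through $P$ containing a point of $S$, and the width of $S$ is $W_S=\min_P w_S(P)$; a cone is wide if the width of its carrier is at least $\lfloor (q+2)/2\rfloor$. -}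

module Defs where

open import Level using (0ℓ)
open import Data.Nat as ℕ using (ℕ; _≤_; ⌊_/2⌋)
open import Data.Fin using (Fin; zero; suc)
open import Data.Product using (Σ; ∃; _×_; _,_)
open import Data.Sum using (_⊎_)
open import Relation.Nullary using (¬_)
open import Relation.Binary.PropositionalEquality using (_≡_)
open import Function.Bundles using (_↔_)
open import Algebra.Structures using (IsCommutativeRing)

-- A finite field with q elements; every finite field is
-- GF(q) for a prime power q (and GF(q) is unique up to isomorphism), so
-- quantifying over all such records is quantifying over all GF(q).

record FiniteField : Set₁ where
  infixl 6 _+_
  infixl 7 _*_
  field
    Carrier : Set
    _+_ _*_ : Carrier → Carrier → Carrier
    -_      : Carrier → Carrier
    0# 1#   : Carrier
    isCommutativeRing : IsCommutativeRing _≡_ _+_ _*_ -_ 0# 1#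
    0≢1     : ¬ (0# ≡ 1#)
    inverse : ∀ x → ¬ (x ≡ 0#) → ∃ λ y → x * y ≡ 1#
    order   : ℕ
    enum    : Fin order ↔ Carrier

-- Geometry of PG(3,q) over a finite field F, with homogeneous coordinates
-- (x0,x1,x2,x3).  Points are nonzero vectors; two vectors represent the
-- same point iff they are proportional.

module Geometry (F : FiniteField) where
  open FiniteField F

  q : ℕ
  q = order

  V4 : Set
  V4 = Fin 4 → Carrier

  V3 : Set
  V3 = Fin 3 → Carrier

  IsZero4 : V4 → Set
  IsZero4 x = ∀ i → x i ≡ 0#

  IsZero3 : V3 → Set
  IsZero3 x = ∀ i → x i ≡ 0#

  -- points of PG(3,q) and of the plane π₀ (as nonzero representatives)
  Point : Set
  Point = Σ V4 λ x → ¬ IsZero4 x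

  Point3 : Set
  Point3 = Σ V3 λ x → ¬ IsZero3 x

  SamePoint : V4 → V4 → Set
  SamePoint x y = Σ Carrier λ c → ¬ (c ≡ 0#) × (∀ i → x i ≡ c * y i)

  SamePoint3 : V3 → V3 → Set
  SamePoint3 x y = Σ Carrier λ c → ¬ (c ≡ 0#) × (∀ i → x i ≡ c * y i)

  lin : Carrier → V4 → Carrier → V4 → V4
  lin a u b v i = a * u i + b * v i

  vertexV : V4
  vertexV zero = 0#
  vertexV (suc zero) = 0#
  vertexV (suc (suc zero)) = 0#
  vertexV (suc (suc (suc zero))) = 1#

  embed : V3 → V4
  embed p zero = p zero
  embed p (suc zero) = p (suc zero)
  embed p (suc (suc zero)) = p (suc (suc zero))
  embed p (suc (suc (suc zero))) = 0#

  -- a set of points of π₀ (membership of a point is membership of the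
  -- chosen representative)
  PointSet : Set₁
  PointSet = Point3 → Set

  Nonempty : PointSet → Set
  Nonempty S = Σ Point3 S

  -- Lines of π₀ are given by nonzero dual vectors (l0,l1,l2):
  -- l0 x0 + l1 x1 + l2 x2 = 0.

  dot3 : V3 → V3 → Carrier
  dot3 l x = l zero * x zero + l (suc zero) * x (suc zero)
             + l (suc (suc zero)) * x (suc (suc zero))

  Line2 : Set
  Line2 = Point3

  OnLine2 : V3 → Line2 → Set
  OnLine2 x (l , _) = dot3 l x ≡ 0#

  MeetsSet : PointSet → Line2 → Set
  MeetsSet S ℓ = Σ Point3 λ Q → S Q × OnLine2 (Data.Product.proj₁ Q) ℓ

  WidthAtLeastAt : PointSet → Point3 → ℕ → Set
  WidthAtLeastAt S (p , _) k =
    Σ (Fin k → Line2) λ ℓ →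
        (∀ i → OnLine2 p (ℓ i) × MeetsSet S (ℓ i))
      × (∀ i j → SamePoint3 (Data.Product.proj₁ (ℓ i)) (Data.Product.proj₁ (ℓ j)) → i ≡ j)

  WidthAtLeast : PointSet → ℕ → Set
  WidthAtLeast S k = ∀ P → WidthAtLeastAt S P k

  Wide : PointSet → Set
  Wide S = WidthAtLeast S ⌊ q ℕ.+ 2 /2⌋

  OnCone : PointSet → Point → Set
  OnCone S (x , _) =
    Σ Point3 λ P → S P × Σ Carrier λ a → Σ Carrier λ b →
      (∀ i → x i ≡ lin a vertexV b (embed (Data.Product.proj₁ P)) i)

  -- Planes.  A general plane is a nonzero dual vector c:
  -- c0 x0 + c1 x1 + c2 x2 + c3 x3 = 0.

  dot4 : V4 → V4 → Carrier
  dot4 c x = c zero * x zero + c (suc zero) * x (suc zero)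
             + c (suc (suc zero)) * x (suc (suc zero))
             + c (suc (suc (suc zero))) * x (suc (suc (suc zero)))

  flockPlane : (Carrier → Carrier) → (Carrier → Carrier) → (Carrier → Carrier)
             → Carrier → V4
  flockPlane f g h t zero = f t
  flockPlane f g h t (suc zero) = g t
  flockPlane f g h t (suc (suc zero)) = h t
  flockPlane f g h t (suc (suc (suc zero))) = - 1#

  OnPlane : V4 → V4 → Set
  OnPlane x c = dot4 c x ≡ 0#

  -- A flock: q distinct planes of the above form, with f(0)=g(0)=h(0)=0.
  -- (Two such planes coincide iff their coefficient triples coincide.)
  record Flock : Set where
    field
      f g h    : Carrier → Carrier
      f0       : f 0# ≡ 0#
      g0       : g 0# ≡ 0#
      h0       : h 0# ≡ 0#
      distinct : ∀ s t → f s ≡ f t → g s ≡ g t → h s ≡ h t → s ≡ t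

  module _ (Fl : Flock) where
    open Flock Fl

    plane : Carrier → V4
    plane = flockPlane f g h

    IsFlockOfCone : PointSet → Set
    IsFlockOfCone S = ∀ s t → ¬ (s ≡ t) → ∀ (X : Point) → OnCone S X →
      ¬ (OnPlane (Data.Product.proj₁ X) (plane s)
         × OnPlane (Data.Product.proj₁ X) (plane t))

    CommonPoint : Point → Set
    CommonPoint (x , _) = ∀ t → OnPlane x (plane t)

    IsStar : Set
    IsStar = Σ Point CommonPoint

    IsProperStar : Set
    IsProperStar = IsStar × (∀ X Y → CommonPoint X → CommonPoint Y →
                     SamePoint (Data.Product.proj₁ X) (Data.Product.proj₁ Y))

  record Line : Set where
    field
      u v   : V4
      indep : ∀ a b → IsZero4 (lin a u b v) → (a ≡ 0#) × (b ≡ 0#)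

  OnLine : V4 → Line → Set
  OnLine x ℓ = Σ Carrier λ a → Σ Carrier λ b → ∀ i → x i ≡ lin a (Line.u ℓ) b (Line.v ℓ) i

  SameLine : Line → Line → Set
  SameLine ℓ m = ∀ (X : Point) →
    (OnLine (Data.Product.proj₁ X) ℓ → OnLine (Data.Product.proj₁ X) m)
    × (OnLine (Data.Product.proj₁ X) m → OnLine (Data.Product.proj₁ X) ℓ)

  PlaneContains : V4 → Line → Set
  PlaneContains c ℓ = ∀ (X : Point) → OnLine (Data.Product.proj₁ X) ℓ →
    OnPlane (Data.Product.proj₁ X) c

  IsBilinear : Flock → Set
  IsBilinear Fl = Σ Line λ ℓ → Σ Line λ m → ¬ SameLine ℓ m ×
    (∀ t → PlaneContains (plane Fl t) ℓ ⊎ PlaneContains (plane Fl t) m)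

-- Let X be the unique common point of the planes. The plane with parameter 0 is π₀, so
-- X = (p₀, 0) with p₀ ∈ π₀, and for s ≠ t the line of π₀ with coordinates coeff s − coeff t
-- (the projection from V of the line where planes s and t meet) is a line through p₀: a
-- chord. As no two planes meet on the cone, chords miss the carrier S.
-- Suppose every plane contains ℓ or m, and the set A of planes containing ℓ is at least as
-- large as the set for m, so that 2|A| ≥ q. Not every plane contains ℓ, since its points
-- would all be common points; pick b ∉ A. If |A| ≥ 2, the chords a₁a₂ and ab (a ∈ A) are
-- |A| + 1 distinct lines through p₀, as any coincidence would put b in A, and none of them
-- is one of the ⌊(q+2)/2⌋ lines through p₀ meeting S. Since only q + 1 lines pass through
-- p₀, this contradicts 2|A| ≥ q. If |A| ≤ 1 then q = 2, and the two planes of the flock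
-- share a whole line.

module Submission where

open import Defs
open import Data.Empty using (⊥)

open import Level using (0ℓ)
open import Algebra.Bundles using (CommutativeRing)
open import Algebra.Solver.Ring.AlmostCommutativeRing
  using (fromCommutativeRing; _-Raw-AlmostCommutative⟶_)
open import Data.Empty using (⊥-elim)
open import Data.Fin as Fin using (Fin; zero; suc; splitAt)
open import Data.Fin.Patterns using (0F; 1F; 2F; 3F)
import Data.Fin.Properties as Fin
open import Data.Integer as ℤ using (ℤ; +_; -[1+_])
import Data.Integer.Properties as ℤ
open import Data.List using (List; []; _∷_; length; lookup; filter; tabulate)
import Data.List.Properties as List
open import Data.List.Membership.Propositional using (_∈_)
open import Data.List.Membership.Propositional.Properties
  using (∈-filter⁺; ∈-filter⁻; ∈-tabulate⁺; ∈-lookup)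
open import Data.List.Relation.Unary.All as All using (All)
open import Data.List.Relation.Unary.Any using (here)
open import Data.List.Relation.Unary.AllPairs as AllPairs using (_∷_)
open import Data.List.Relation.Unary.Unique.Propositional using (Unique)
import Data.List.Relation.Unary.Unique.Propositional.Properties as Unique
open import Data.Maybe using (Maybe; just; nothing)
open import Data.Nat as ℕ using (ℕ; zero; suc; z≤n; s≤s; ⌊_/2⌋; ⌈_/2⌉)
import Data.Nat.Properties as ℕ
open import Data.Product using (Σ; ∃; _×_; _,_; proj₁; proj₂)
open import Data.Sum as Sum using (_⊎_; inj₁; inj₂; [_,_]; [_,_]′; swap)
open import Function using (_∘_)
open import Function.Bundles using (Inverse; Injection)
open import Function.Properties.Inverse using (↔⇒↣; ↔-sym)
open import Function.Definitions using (Injective)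
open import Data.Vec.Functional using (_++_)
import Relation.Binary.PropositionalEquality as ≡
open ≡ using (_≡_; _≢_)
open import Relation.Nullary using (¬_; Dec; yes; no)
open import Relation.Unary using (Decidable)

-- Equality in an abstract ring is not decidable, so the ring solver is instantiated with
-- integer coefficients mapped into the ring.
module IntegerCoefficients {c ℓ} (R : CommutativeRing c ℓ) where
  open CommutativeRing R
  open import Algebra.Properties.Ring ring
    using (-‿distribˡ-*; -‿distribʳ-*; -‿involutive; -0#≈0#; -‿+-comm)
  open import Algebra.Properties.Semiring.Mult.TCOptimised semiring using (1+×; ×-homo-+; ×1-homo-*)
    renaming (_×_ to _×ₙ_)
  open import Relation.Binary.Reasoning.Setoid setoid

  fromℤ : ℤ → Carrier
  fromℤ (+ n)    = n ×ₙ 1#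
  fromℤ -[1+ n ] = - (suc n ×ₙ 1#)

  fromℤ-cong : ∀ {i j} → i ≡ j → fromℤ i ≈ fromℤ j
  fromℤ-cong ≡.refl = refl

  fromℤ-neg+ : ∀ n → fromℤ (ℤ.- + n) ≈ - fromℤ (+ n)
  fromℤ-neg+ zero    = sym -0#≈0#
  fromℤ-neg+ (suc n) = refl

  fromℤ-⊖ : ∀ m n → fromℤ (m ℤ.⊖ n) ≈ m ×ₙ 1# - n ×ₙ 1#
  fromℤ-⊖ zero    zero    = sym (trans (+-identityˡ _) -0#≈0#)
  fromℤ-⊖ zero    (suc n) = sym (+-identityˡ _)
  fromℤ-⊖ (suc m) zero    = sym (trans (+-congˡ -0#≈0#) (+-identityʳ _))
  fromℤ-⊖ (suc m) (suc n) = begin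
    fromℤ (suc m ℤ.⊖ suc n)        ≈⟨ fromℤ-cong (ℤ.[1+m]⊖[1+n]≡m⊖n m n) ⟩
    fromℤ (m ℤ.⊖ n)                ≈⟨ fromℤ-⊖ m n ⟩
    a - b                          ≈⟨ +-congʳ (sym (+-identityˡ a)) ⟩
    (0# + a) - b                   ≈⟨ +-congʳ (+-congʳ (sym (-‿inverseʳ 1#))) ⟩
    ((1# - 1#) + a) - b            ≈⟨ +-congʳ (+-assoc 1# (- 1#) a) ⟩
    (1# + (- 1# + a)) - b          ≈⟨ +-congʳ (+-congˡ (+-comm (- 1#) a)) ⟩
    (1# + (a - 1#)) - b            ≈⟨ +-congʳ (sym (+-assoc 1# a (- 1#))) ⟩
    ((1# + a) - 1#) - b            ≈⟨ +-assoc (1# + a) (- 1#) (- b) ⟩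
    (1# + a) + (- 1# - b)          ≈⟨ +-congˡ (-‿+-comm 1# b) ⟩
    (1# + a) - (1# + b)            ≈⟨ +-cong (1+× m 1#) (-‿cong (1+× n 1#)) ⟨
    suc m ×ₙ 1# - suc n ×ₙ 1#      ∎
    where
      a b : Carrier
      a = m ×ₙ 1#
      b = n ×ₙ 1#

  fromℤ-+ : ∀ i j → fromℤ (i ℤ.+ j) ≈ fromℤ i + fromℤ j
  fromℤ-+ -[1+ m ] -[1+ n ] = begin
    - (suc (suc (m ℕ.+ n)) ×ₙ 1#)    ≈⟨ -‿cong (fromℤ-cong (≡.cong (ℤ.+_) (≡.cong suc (ℕ.+-suc m n)))) ⟨
    - ((suc m ℕ.+ suc n) ×ₙ 1#)      ≈⟨ -‿cong (×-homo-+ 1# (suc m) (suc n)) ⟩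
    - (suc m ×ₙ 1# + suc n ×ₙ 1#)    ≈⟨ -‿+-comm _ _ ⟨
    - (suc m ×ₙ 1#) - suc n ×ₙ 1#    ∎
  fromℤ-+ -[1+ m ] (+ n)    = trans (fromℤ-⊖ n (suc m)) (+-comm _ _)
  fromℤ-+ (+ m)    -[1+ n ] = fromℤ-⊖ m (suc n)
  fromℤ-+ (+ m)    (+ n)    = ×-homo-+ 1# m n

  fromℤ-* : ∀ i j → fromℤ (i ℤ.* j) ≈ fromℤ i * fromℤ j
  fromℤ-* (+ m) (+ n) = trans (fromℤ-cong (ℤ.+◃n≡+n (m ℕ.* n))) (×1-homo-* m n)
  fromℤ-* (+ m) -[1+ n ] = begin
    fromℤ (+ m ℤ.* -[1+ n ])         ≈⟨ fromℤ-cong (ℤ.-◃n≡-n (m ℕ.* suc n)) ⟩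
    fromℤ (ℤ.- + (m ℕ.* suc n))      ≈⟨ fromℤ-neg+ (m ℕ.* suc n) ⟩
    - ((m ℕ.* suc n) ×ₙ 1#)          ≈⟨ -‿cong (×1-homo-* m (suc n)) ⟩
    - (m ×ₙ 1# * suc n ×ₙ 1#)        ≈⟨ -‿distribʳ-* _ _ ⟩
    m ×ₙ 1# * - (suc n ×ₙ 1#)        ∎
  fromℤ-* -[1+ m ] (+ n) = begin
    fromℤ (-[1+ m ] ℤ.* + n)         ≈⟨ fromℤ-cong (ℤ.-◃n≡-n (suc m ℕ.* n)) ⟩
    fromℤ (ℤ.- + (suc m ℕ.* n))      ≈⟨ fromℤ-neg+ (suc m ℕ.* n) ⟩
    - ((suc m ℕ.* n) ×ₙ 1#)          ≈⟨ -‿cong (×1-homo-* (suc m) n) ⟩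
    - (suc m ×ₙ 1# * n ×ₙ 1#)        ≈⟨ -‿distribˡ-* _ _ ⟩
    - (suc m ×ₙ 1#) * n ×ₙ 1#        ∎
  fromℤ-* -[1+ m ] -[1+ n ] = begin
    (suc m ℕ.* suc n) ×ₙ 1#            ≈⟨ ×1-homo-* (suc m) (suc n) ⟩
    suc m ×ₙ 1# * suc n ×ₙ 1#          ≈⟨ *-congʳ (-‿involutive _) ⟨
    - - (suc m ×ₙ 1#) * suc n ×ₙ 1#    ≈⟨ -‿distribˡ-* _ _ ⟨
    - (- (suc m ×ₙ 1#) * suc n ×ₙ 1#)  ≈⟨ -‿distribʳ-* _ _ ⟩
    - (suc m ×ₙ 1#) * - (suc n ×ₙ 1#)  ∎

  fromℤ-neg : ∀ i → fromℤ (ℤ.- i) ≈ - fromℤ i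
  fromℤ-neg (+ n)    = fromℤ-neg+ n
  fromℤ-neg -[1+ n ] = sym (-‿involutive _)

  morphism : ℤ.+-*-rawRing -Raw-AlmostCommutative⟶ fromCommutativeRing R
  morphism = record
    { ⟦_⟧    = fromℤ
    ; +-homo = fromℤ-+
    ; *-homo = fromℤ-*
    ; -‿homo = fromℤ-neg
    ; 0-homo = refl
    ; 1-homo = refl
    }

  fromℤ-≟ : ∀ i j → Maybe (fromℤ i ≈ fromℤ j)
  fromℤ-≟ i j with i ℤ.≟ j
  ... | yes i≡j = just (fromℤ-cong i≡j)
  ... | no _    = nothing

  open import Algebra.Solver.Ring ℤ.+-*-rawRing (fromCommutativeRing R) morphism fromℤ-≟ public

module _ {a} {A : Set a} where

  lookup-injective : ∀ {xs : List A} → Unique xs → ∀ i j → lookup xs i ≡ lookup xs j → i ≡ j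
  lookup-injective (_ ∷ _)     zero    zero    _  = ≡.refl
  lookup-injective (x∉ ∷ _)    zero    (suc j) eq = ⊥-elim (All.lookup x∉ (∈-lookup j) eq)
  lookup-injective (x∉ ∷ _)    (suc i) zero    eq = ⊥-elim (All.lookup x∉ (∈-lookup i) (≡.sym eq))
  lookup-injective (_ ∷ uniq)  (suc i) (suc j) eq = ≡.cong suc (lookup-injective uniq i j eq)

  length-≤-filter-+-filter : ∀ {p q} {P : A → Set p} {Q : A → Set q} (P? : Decidable P) (Q? : Decidable Q) →
    (∀ x → P x ⊎ Q x) → ∀ xs → length xs ℕ.≤ length (filter P? xs) ℕ.+ length (filter Q? xs)
  length-≤-filter-+-filter P? Q? P∪Q [] = z≤n
  length-≤-filter-+-filter P? Q? P∪Q (x ∷ xs) with ih ← length-≤-filter-+-filter P? Q? P∪Q xs | P? x | Q? x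
  ... | yes _ | no _  = s≤s ih
  ... | yes _ | yes _ = s≤s (ℕ.≤-trans ih (ℕ.+-monoʳ-≤ (length (filter P? xs)) (ℕ.n≤1+n _)))
  ... | no _  | yes _ = ℕ.≤-trans (s≤s ih) (ℕ.≤-reflexive (≡.sym (ℕ.+-suc _ _)))
  ... | no ¬p | no ¬q = ⊥-elim ([ ¬p , ¬q ] (P∪Q x))

splitAt-injective : ∀ m {n} → Injective _≡_ _≡_ (splitAt m {n})
splitAt-injective m {n} {i} {j} eq =
  ≡.trans (≡.sym (Fin.join-splitAt m n i)) (≡.trans (≡.cong (Fin.join m n) eq) (Fin.join-splitAt m n j))

width+chords>q+1 : ∀ q n → q ℕ.≤ n ℕ.+ n → suc q ℕ.< ⌊ q ℕ.+ 2 /2⌋ ℕ.+ suc n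
width+chords>q+1 q n q≤2n = begin-strict
  suc q                          ≡⟨ ≡.cong suc (ℕ.⌊n/2⌋+⌈n/2⌉≡n q) ⟨
  suc (⌊ q /2⌋ ℕ.+ ⌈ q /2⌉)      ≤⟨ s≤s (ℕ.+-monoʳ-≤ ⌊ q /2⌋ ⌈q/2⌉≤n) ⟩
  suc (⌊ q /2⌋ ℕ.+ n)            <⟨ ℕ.n<1+n _ ⟩
  suc (suc (⌊ q /2⌋ ℕ.+ n))      ≡⟨ ≡.cong suc (ℕ.+-suc ⌊ q /2⌋ n) ⟨
  ⌊ 2 ℕ.+ q /2⌋ ℕ.+ suc n        ≡⟨ ≡.cong (λ k → ⌊ k /2⌋ ℕ.+ suc n) (ℕ.+-comm 2 q) ⟩
  ⌊ q ℕ.+ 2 /2⌋ ℕ.+ suc n        ∎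
  where
    open ℕ.≤-Reasoning
    ⌈q/2⌉≤n : ⌈ q /2⌉ ℕ.≤ n
    ⌈q/2⌉≤n = ℕ.≤-trans (ℕ.⌈n/2⌉-mono q≤2n) (ℕ.≤-reflexive (≡.sym (ℕ.n≡⌈n+n/2⌉ n)))

module Flocks (F : FiniteField) where
  open FiniteField F
  open Geometry F
  open ≡ using (refl; sym; trans; cong; cong₂; subst)
  open ≡.≡-Reasoning

  commutativeRing : CommutativeRing 0ℓ 0ℓ
  commutativeRing = record { isCommutativeRing = isCommutativeRing }

  open IntegerCoefficients commutativeRing using (solve; _:=_; _:+_; _:*_; :-_; _:-_; con; Polynomial)

  :0 :1 : ∀ {n} → Polynomial n
  :0 = con (+ 0)
  :1 = con (+ 1)

  infixl 6 _-_
  _-_ : Carrier → Carrier → Carrier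
  x - y = x + - y

  to : Fin q → Carrier
  to = Inverse.to enum

  from : Carrier → Fin q
  from = Inverse.from enum

  to-from : ∀ x → to (from x) ≡ x
  to-from = Inverse.strictlyInverseˡ enum

  to-injective : Injective _≡_ _≡_ to
  to-injective = Injection.injective (↔⇒↣ enum)

  from-injective : Injective _≡_ _≡_ from
  from-injective = Injection.injective (↔⇒↣ (↔-sym enum))

  _≟_ : (x y : Carrier) → Dec (x ≡ y)
  x ≟ y with from x Fin.≟ from y
  ... | yes eq  = yes (from-injective eq)
  ... | no ¬eq  = no (¬eq ∘ cong from)

  ¬∀⇒∃¬ : ∀ {P : Carrier → Set} → Decidable P → ¬ (∀ x → P x) → ∃ λ x → ¬ P x
  ¬∀⇒∃¬ {P} P? ¬∀P
    with Fin.¬∀⟶∃¬ q (P ∘ to) (P? ∘ to) (λ ∀P → ¬∀P (λ x → subst P (to-from x) (∀P (from x))))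
  ... | i , ¬Pi = to i , ¬Pi

  2≤q : 2 ℕ.≤ q
  2≤q = Fin.injective⇒≤ {f = zeroOne} injective
    where
      zeroOne : Fin 2 → Fin q
      zeroOne zero       = from 0#
      zeroOne (suc zero) = from 1#
      injective : Injective _≡_ _≡_ zeroOne
      injective {zero}     {zero}     _  = refl
      injective {zero}     {suc zero} eq = ⊥-elim (0≢1 (from-injective eq))
      injective {suc zero} {zero}     eq = ⊥-elim (0≢1 (from-injective (sym eq)))
      injective {suc zero} {suc zero} _  = refl

  inv : (x : Carrier) → x ≢ 0# → Carrier
  inv x x≢0 = proj₁ (inverse x x≢0)

  *-inverseʳ : ∀ x (x≢0 : x ≢ 0#) → x * inv x x≢0 ≡ 1#
  *-inverseʳ x x≢0 = proj₂ (inverse x x≢0)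

  *-zeroʳ : ∀ x → x * 0# ≡ 0#
  *-zeroʳ = solve 1 (λ x → x :* :0 := :0) refl

  *-zeroˡ : ∀ x → 0# * x ≡ 0#
  *-zeroˡ = solve 1 (λ x → :0 :* x := :0) refl

  *-cancelˡ : ∀ {x y z} → x ≢ 0# → x * y ≡ x * z → y ≡ z
  *-cancelˡ {x} {y} {z} x≢0 eq = begin
    y                ≡⟨ solve 1 (λ y → y := :1 :* y) refl y ⟩
    1# * y           ≡⟨ cong (_* y) (*-inverseʳ x x≢0) ⟨
    (x * x⁻¹) * y    ≡⟨ solve 3 (λ x i y → (x :* i) :* y := i :* (x :* y)) refl x x⁻¹ y ⟩
    x⁻¹ * (x * y)    ≡⟨ cong (x⁻¹ *_) eq ⟩
    x⁻¹ * (x * z)    ≡⟨ solve 3 (λ x i z → i :* (x :* z) := (x :* i) :* z) refl x x⁻¹ z ⟩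
    (x * x⁻¹) * z    ≡⟨ cong (_* z) (*-inverseʳ x x≢0) ⟩
    1# * z           ≡⟨ solve 1 (λ z → :1 :* z := z) refl z ⟩
    z                ∎
    where
      x⁻¹ : Carrier
      x⁻¹ = inv x x≢0

  x*y≡0⇒y≡0 : ∀ {x y} → x ≢ 0# → x * y ≡ 0# → y ≡ 0#
  x*y≡0⇒y≡0 {x} x≢0 xy≡0 = *-cancelˡ x≢0 (trans xy≡0 (sym (*-zeroʳ x)))

  *-≢0 : ∀ {x y} → x ≢ 0# → y ≢ 0# → x * y ≢ 0#
  *-≢0 x≢0 y≢0 = y≢0 ∘ x*y≡0⇒y≡0 x≢0

  inv-≢0 : ∀ x (x≢0 : x ≢ 0#) → inv x x≢0 ≢ 0#
  inv-≢0 x x≢0 x⁻¹≡0 = 0≢1 (trans (sym (trans (cong (x *_) x⁻¹≡0) (*-zeroʳ x))) (*-inverseʳ x x≢0))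

  x-z≡y-z⇒x≡y : ∀ {x y z} → x - z ≡ y - z → x ≡ y
  x-z≡y-z⇒x≡y {x} {y} {z} eq = begin
    x              ≡⟨ solve 2 (λ x z → x := (x :- z) :+ z) refl x z ⟩
    (x - z) + z    ≡⟨ cong (_+ z) eq ⟩
    (y - z) + z    ≡⟨ solve 2 (λ y z → (y :- z) :+ z := y) refl y z ⟩
    y              ∎

  x≡y⇒x-y≡0 : ∀ {x y} → x ≡ y → x - y ≡ 0#
  x≡y⇒x-y≡0 {x} refl = solve 1 (λ x → x :- x := :0) refl x

  x-y≡0⇒x≡y : ∀ {x y} → x - y ≡ 0# → x ≡ y
  x-y≡0⇒x≡y {y = y} x-y≡0 = x-z≡y-z⇒x≡y (trans x-y≡0 (sym (x≡y⇒x-y≡0 {y} refl)))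

  -x≡0⇒x≡0 : ∀ {x} → - x ≡ 0# → x ≡ 0#
  -x≡0⇒x≡0 {x} -x≡0 = begin
    x       ≡⟨ solve 1 (λ x → x := :- (:- x)) refl x ⟩
    - - x   ≡⟨ cong -_ -x≡0 ⟩
    - 0#    ≡⟨ solve 0 (:- :0 := :0) refl ⟩
    0#      ∎

  elements : List Carrier
  elements = tabulate to

  ∈-elements : ∀ x → x ∈ elements
  ∈-elements x = subst (_∈ elements) (to-from x) (∈-tabulate⁺ (from x))

  elements-unique : Unique elements
  elements-unique = Unique.tabulate⁺ to-injective

  length-elements : length elements ≡ q
  length-elements = List.length-tabulate to

  SamePoint3-sym : ∀ {x y} → SamePoint3 x y → SamePoint3 y x
  SamePoint3-sym {x} {y} (c , c≢0 , x≡cy) = inv c c≢0 , inv-≢0 c c≢0 , λ i → begin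
    y i                        ≡⟨ solve 1 (λ y → y := :1 :* y) refl (y i) ⟩
    1# * y i                   ≡⟨ cong (_* y i) (*-inverseʳ c c≢0) ⟨
    (c * c⁻¹) * y i            ≡⟨ solve 3 (λ c d y → (c :* d) :* y := d :* (c :* y)) refl c c⁻¹ (y i) ⟩
    c⁻¹ * (c * y i)            ≡⟨ cong (c⁻¹ *_) (x≡cy i) ⟨
    c⁻¹ * x i                  ∎
    where
      c⁻¹ : Carrier
      c⁻¹ = inv c c≢0

  dot3-proportional : ∀ {x y c} Q → (∀ i → x i ≡ c * y i) → dot3 x Q ≡ c * dot3 y Q
  dot3-proportional {x} {y} {c} Q x≡cy = begin
    dot3 x Q
      ≡⟨ cong₂ _+_ (cong₂ _+_ (cong (_* Q 0F) (x≡cy 0F)) (cong (_* Q 1F) (x≡cy 1F))) (cong (_* Q 2F) (x≡cy 2F)) ⟩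
    (c * y 0F) * Q 0F + (c * y 1F) * Q 1F + (c * y 2F) * Q 2F
      ≡⟨ solve 7 (λ c y₀ y₁ y₂ q₀ q₁ q₂ → (c :* y₀) :* q₀ :+ (c :* y₁) :* q₁ :+ (c :* y₂) :* q₂
                                         := c :* (y₀ :* q₀ :+ y₁ :* q₁ :+ y₂ :* q₂))
                 refl c (y 0F) (y 1F) (y 2F) (Q 0F) (Q 1F) (Q 2F) ⟩
    c * dot3 y Q
      ∎

  SamePoint3-dot3≡0 : ∀ {x y} Q → SamePoint3 x y → dot3 y Q ≡ 0# → dot3 x Q ≡ 0#
  SamePoint3-dot3≡0 {x} {y} Q (c , _ , x≡cy) yQ≡0 =
    trans (dot3-proportional Q x≡cy) (trans (cong (c *_) yQ≡0) (*-zeroʳ c))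

  record LinesThrough (p : V3) {n : ℕ} (ℓ : Fin n → V3) : Set where
    field
      nonzero  : ∀ i → ¬ IsZero3 (ℓ i)
      incident : ∀ i → dot3 (ℓ i) p ≡ 0#
      distinct : Injective _≡_ SamePoint3 ℓ

  -- numbers the q + 1 points (0 : 1) and (1 : t) of the projective line
  lineIndex : Carrier → Carrier → Fin (suc q)
  lineIndex a b with a ≟ 0#
  ... | yes _   = zero
  ... | no a≢0  = suc (from (b * inv a a≢0))

  lineIndex-injective : ∀ {a b a' b'} → ¬ (a ≡ 0# × b ≡ 0#) → ¬ (a' ≡ 0# × b' ≡ 0#) →
    lineIndex a b ≡ lineIndex a' b' → Σ Carrier λ c → c ≢ 0# × a ≡ c * a' × b ≡ c * b'
  lineIndex-injective {a} {b} {a'} {b'} ab≢0 a'b'≢0 eq with a ≟ 0# | a' ≟ 0#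
  ... | yes a≡0 | yes a'≡0 = c , *-≢0 b≢0 (inv-≢0 b' b'≢0) , a≡ca' , b≡cb'
    where
      b≢0 : b ≢ 0#
      b≢0 b≡0 = ab≢0 (a≡0 , b≡0)
      b'≢0 : b' ≢ 0#
      b'≢0 b'≡0 = a'b'≢0 (a'≡0 , b'≡0)
      c : Carrier
      c = b * inv b' b'≢0
      a≡ca' : a ≡ c * a'
      a≡ca' = trans a≡0 (trans (sym (*-zeroʳ c)) (cong (c *_) (sym a'≡0)))
      b≡cb' : b ≡ c * b'
      b≡cb' = begin
        b                         ≡⟨ solve 1 (λ b → b := b :* :1) refl b ⟩
        b * 1#                    ≡⟨ cong (b *_) (*-inverseʳ b' b'≢0) ⟨
        b * (b' * inv b' b'≢0)    ≡⟨ solve 3 (λ b b' i → b :* (b' :* i) := (b :* i) :* b') refl b b' (inv b' b'≢0) ⟩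
        c * b'                    ∎
  ... | yes _ | no _ with () ← eq
  ... | no _ | yes _ with () ← eq
  ... | no a≢0 | no a'≢0 = c , *-≢0 a≢0 (inv-≢0 a' a'≢0) , a≡ca' , b≡cb'
    where
      a⁻¹ a'⁻¹ c : Carrier
      a⁻¹  = inv a a≢0
      a'⁻¹ = inv a' a'≢0
      c    = a * a'⁻¹
      a≡ca' : a ≡ c * a'
      a≡ca' = begin
        a                  ≡⟨ solve 1 (λ a → a := a :* :1) refl a ⟩
        a * 1#             ≡⟨ cong (a *_) (*-inverseʳ a' a'≢0) ⟨
        a * (a' * a'⁻¹)    ≡⟨ solve 3 (λ a a' i → a :* (a' :* i) := (a :* i) :* a') refl a a' a'⁻¹ ⟩
        c * a'             ∎
      b≡cb' : b ≡ c * b'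
      b≡cb' = begin
        b                  ≡⟨ solve 1 (λ b → b := b :* :1) refl b ⟩
        b * 1#             ≡⟨ cong (b *_) (*-inverseʳ a a≢0) ⟨
        b * (a * a⁻¹)      ≡⟨ solve 3 (λ b a i → b :* (a :* i) := a :* (b :* i)) refl b a a⁻¹ ⟩
        a * (b * a⁻¹)      ≡⟨ cong (a *_) (from-injective (Fin.suc-injective eq)) ⟩
        a * (b' * a'⁻¹)    ≡⟨ solve 3 (λ a b' i → a :* (b' :* i) := (a :* i) :* b') refl a b' a'⁻¹ ⟩
        c * b'             ∎

  module _ {p : V3} (p₂≢0 : p 2F ≢ 0#) where

    incident-third : ∀ {d d' c} → dot3 d p ≡ 0# → dot3 d' p ≡ 0# →
      d 0F ≡ c * d' 0F → d 1F ≡ c * d' 1F → d 2F ≡ c * d' 2F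
    incident-third {d} {d'} {c} d⊥p d'⊥p d₀≡ d₁≡ = *-cancelˡ p₂≢0 (begin
      p 2F * d 2F
        ≡⟨ solve 8 (λ c e₀ e₁ e₂ d₂ p₀ p₁ p₂ →
             p₂ :* d₂ := ((c :* e₀) :* p₀ :+ (c :* e₁) :* p₁ :+ d₂ :* p₂)
                         :- c :* (e₀ :* p₀ :+ e₁ :* p₁ :+ e₂ :* p₂) :+ p₂ :* (c :* e₂))
             refl c (d' 0F) (d' 1F) (d' 2F) (d 2F) (p 0F) (p 1F) (p 2F) ⟩
      ((c * d' 0F) * p 0F + (c * d' 1F) * p 1F + d 2F * p 2F) - c * dot3 d' p + p 2F * (c * d' 2F)
        ≡⟨ cong₂ (λ x y → (x * p 0F + y * p 1F + d 2F * p 2F) - c * dot3 d' p + p 2F * (c * d' 2F)) d₀≡ d₁≡ ⟨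
      dot3 d p - c * dot3 d' p + p 2F * (c * d' 2F)
        ≡⟨ cong₂ (λ x y → x - c * y + p 2F * (c * d' 2F)) d⊥p d'⊥p ⟩
      0# - c * 0# + p 2F * (c * d' 2F)
        ≡⟨ solve 2 (λ c x → :0 :- c :* :0 :+ x := x) refl c (p 2F * (c * d' 2F)) ⟩
      p 2F * (c * d' 2F) ∎)

    leading≢0 : ∀ {d} → ¬ IsZero3 d → dot3 d p ≡ 0# → ¬ (d 0F ≡ 0# × d 1F ≡ 0#)
    leading≢0 {d} d≢0 d⊥p (d₀≡0 , d₁≡0) = d≢0 λ
      { 0F → d₀≡0
      ; 1F → d₁≡0
      ; 2F → trans (incident-third {d = d} {d' = d} {c = 0#} d⊥p d⊥p
                      (trans d₀≡0 (sym (*-zeroˡ (d 0F)))) (trans d₁≡0 (sym (*-zeroˡ (d 1F)))))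
                   (*-zeroˡ (d 2F))
      }

    linesThrough-≤₂ : ∀ {n} {ℓ : Fin n → V3} → LinesThrough p ℓ → n ℕ.≤ suc q
    linesThrough-≤₂ {n} {ℓ} lines = Fin.injective⇒≤ {f = index} index-injective
      where
        open LinesThrough lines
        index : Fin n → Fin (suc q)
        index i = lineIndex (ℓ i 0F) (ℓ i 1F)
        index-injective : Injective _≡_ _≡_ index
        index-injective {i} {j} eq with lineIndex-injective (leading≢0 (nonzero i) (incident i))
                                                            (leading≢0 (nonzero j) (incident j)) eq
        ... | c , c≢0 , e₀ , e₁ = distinct (c , c≢0 , λ
          { 0F → e₀ ; 1F → e₁ ; 2F → incident-third {d = ℓ i} {d' = ℓ j} (incident i) (incident j) e₀ e₁ })

  -- a cyclic change of coordinates, to make the last coordinate of p nonzero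
  rotate : V3 → V3
  rotate x 0F = x 1F
  rotate x 1F = x 2F
  rotate x 2F = x 0F

  rotate-LinesThrough : ∀ {p n} {ℓ : Fin n → V3} → LinesThrough p ℓ → LinesThrough (rotate p) (rotate ∘ ℓ)
  rotate-LinesThrough {p} {ℓ = ℓ} lines = record
    { nonzero  = λ i ℓᵢ≡0 → nonzero i λ { 0F → ℓᵢ≡0 2F ; 1F → ℓᵢ≡0 0F ; 2F → ℓᵢ≡0 1F }
    ; incident = λ i → trans (solve 6 (λ a b c x y z → b :* y :+ c :* z :+ a :* x := a :* x :+ b :* y :+ c :* z) refl
                                 (ℓ i 0F) (ℓ i 1F) (ℓ i 2F) (p 0F) (p 1F) (p 2F))
                             (incident i)
    ; distinct = λ { (c , c≢0 , e) → distinct (c , c≢0 , λ { 0F → e 2F ; 1F → e 0F ; 2F → e 1F }) }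
    }
    where open LinesThrough lines

  linesThrough-≤ : ∀ {p n} {ℓ : Fin n → V3} → ¬ IsZero3 p → LinesThrough p ℓ → n ℕ.≤ suc q
  linesThrough-≤ {p} p≢0 lines with p 2F ≟ 0# | p 1F ≟ 0# | p 0F ≟ 0#
  ... | no p₂≢0 | _       | _       = linesThrough-≤₂ p₂≢0 lines
  ... | yes _   | no p₁≢0 | _       = linesThrough-≤₂ p₁≢0 (rotate-LinesThrough (rotate-LinesThrough lines))
  ... | yes _   | yes _   | no p₀≢0 = linesThrough-≤₂ p₀≢0 (rotate-LinesThrough lines)
  ... | yes p₂≡0 | yes p₁≡0 | yes p₀≡0 = ⊥-elim (p≢0 λ { 0F → p₀≡0 ; 1F → p₁≡0 ; 2F → p₂≡0 })

  vec3 : Carrier → Carrier → Carrier → V3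
  vec3 a b c 0F = a
  vec3 a b c 1F = b
  vec3 a b c 2F = c

  record TwoPointsOn (w : V3) : Set where
    field
      y y'         : V3
      y≢0          : ¬ IsZero3 y
      y'≢0         : ¬ IsZero3 y'
      on           : dot3 w y ≡ 0#
      on'          : dot3 w y' ≡ 0#
      different    : ¬ SamePoint3 y y'

  twoPointsOn : ∀ w → TwoPointsOn w
  twoPointsOn w with w 0F ≟ 0# | w 2F ≟ 0#
  ... | no w₀≢0 | _ = record
    { y = vec3 (w 1F) (- w 0F) 0# ; y' = vec3 (w 2F) 0# (- w 0F)
    ; y≢0 = λ y≡0 → w₀≢0 (-x≡0⇒x≡0 (y≡0 1F))
    ; y'≢0 = λ y'≡0 → w₀≢0 (-x≡0⇒x≡0 (y'≡0 2F))
    ; on = solve 3 (λ a b c → a :* b :+ b :* (:- a) :+ c :* :0 := :0) refl (w 0F) (w 1F) (w 2F)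
    ; on' = solve 3 (λ a b c → a :* c :+ b :* :0 :+ c :* (:- a) := :0) refl (w 0F) (w 1F) (w 2F)
    ; different = λ { (c , _ , e) → w₀≢0 (-x≡0⇒x≡0 (trans (e 1F) (*-zeroʳ c))) }
    }
  ... | yes w₀≡0 | no w₂≢0 = record
    { y = vec3 1# 0# 0# ; y' = vec3 0# (w 2F) (- w 1F)
    ; y≢0 = λ y≡0 → 0≢1 (sym (y≡0 0F))
    ; y'≢0 = λ y'≡0 → w₂≢0 (y'≡0 1F)
    ; on = trans (solve 3 (λ a b c → a :* :1 :+ b :* :0 :+ c :* :0 := a) refl (w 0F) (w 1F) (w 2F)) w₀≡0
    ; on' = solve 3 (λ a b c → a :* :0 :+ b :* c :+ c :* (:- b) := :0) refl (w 0F) (w 1F) (w 2F)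
    ; different = λ { (c , _ , e) → 0≢1 (sym (trans (e 0F) (*-zeroʳ c))) }
    }
  ... | yes w₀≡0 | yes w₂≡0 = record
    { y = vec3 1# 0# 0# ; y' = vec3 0# 0# 1#
    ; y≢0 = λ y≡0 → 0≢1 (sym (y≡0 0F))
    ; y'≢0 = λ y'≡0 → 0≢1 (sym (y'≡0 2F))
    ; on = trans (solve 3 (λ a b c → a :* :1 :+ b :* :0 :+ c :* :0 := a) refl (w 0F) (w 1F) (w 2F)) w₀≡0
    ; on' = trans (solve 3 (λ a b c → a :* :0 :+ b :* :0 :+ c :* :1 := c) refl (w 0F) (w 1F) (w 2F)) w₂≡0
    ; different = λ { (c , _ , e) → 0≢1 (sym (trans (e 0F) (*-zeroʳ c))) }
    }

  linesThrough-++ : ∀ {p m n} {ℓ : Fin m → V3} {ℓ' : Fin n → V3} → LinesThrough p ℓ → LinesThrough p ℓ' →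
    (∀ i j → ¬ SamePoint3 (ℓ i) (ℓ' j)) → LinesThrough p (ℓ ++ ℓ')
  linesThrough-++ {p} {m} {n} {ℓ} {ℓ'} L L' apart = record
    { nonzero  = nonzero ∘ splitAt m
    ; incident = incident ∘ splitAt m
    ; distinct = λ {i} {j} same → splitAt-injective m (distinct (splitAt m i) (splitAt m j) same)
    }
    where
      module L  = LinesThrough L
      module L' = LinesThrough L'
      nonzero : ∀ x → ¬ IsZero3 ([ ℓ , ℓ' ] x)
      nonzero (inj₁ i) = L.nonzero i
      nonzero (inj₂ j) = L'.nonzero j
      incident : ∀ x → dot3 ([ ℓ , ℓ' ] x) p ≡ 0#
      incident (inj₁ i) = L.incident i
      incident (inj₂ j) = L'.incident j
      distinct : ∀ x y → SamePoint3 ([ ℓ , ℓ' ] x) ([ ℓ , ℓ' ] y) → x ≡ y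
      distinct (inj₁ i) (inj₁ i') same = cong inj₁ (L.distinct same)
      distinct (inj₁ i) (inj₂ j)  same = ⊥-elim (apart i j same)
      distinct (inj₂ j) (inj₁ i)  same = ⊥-elim (apart i j (SamePoint3-sym same))
      distinct (inj₂ j) (inj₂ j') same = cong inj₂ (L'.distinct same)

  toπ₀ : V4 → V3
  toπ₀ x = vec3 (x 0F) (x 1F) (x 2F)

  module FlockGeometry (S : PointSet) (Fl : Flock) where
    open Flock Fl

    coeff : Carrier → V3
    coeff t = vec3 (f t) (g t) (h t)

    chord : Carrier → Carrier → V3
    chord s t i = coeff s i - coeff t i

    coeff-0 : IsZero3 (coeff 0#)
    coeff-0 0F = f0
    coeff-0 1F = g0
    coeff-0 2F = h0

    coeff-injective : ∀ {s t} → (∀ i → coeff s i ≡ coeff t i) → s ≡ t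
    coeff-injective {s} {t} eq = distinct s t (eq 0F) (eq 1F) (eq 2F)

    chord-≢0 : ∀ {s t} → s ≢ t → ¬ IsZero3 (chord s t)
    chord-≢0 s≢t chord≡0 = s≢t (coeff-injective (x-y≡0⇒x≡y ∘ chord≡0))

    plane-eval : ∀ t x → dot4 (plane Fl t) x ≡ dot3 (coeff t) (toπ₀ x) - x 3F
    plane-eval t x = solve 7 (λ a b c x₀ x₁ x₂ x₃ →
                               a :* x₀ :+ b :* x₁ :+ c :* x₂ :+ (:- :1) :* x₃
                               := a :* x₀ :+ b :* x₁ :+ c :* x₂ :- x₃)
                             refl (f t) (g t) (h t) (x 0F) (x 1F) (x 2F) (x 3F)

    plane-chord : ∀ s t x → dot4 (plane Fl s) x - dot4 (plane Fl t) x ≡ dot3 (chord s t) (toπ₀ x)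
    plane-chord s t x = solve 10 (λ a b c a' b' c' x₀ x₁ x₂ x₃ →
        (a :* x₀ :+ b :* x₁ :+ c :* x₂ :+ (:- :1) :* x₃) :- (a' :* x₀ :+ b' :* x₁ :+ c' :* x₂ :+ (:- :1) :* x₃)
        := (a :- a') :* x₀ :+ (b :- b') :* x₁ :+ (c :- c') :* x₂)
      refl (f s) (g s) (h s) (f t) (g t) (h t) (x 0F) (x 1F) (x 2F) (x 3F)

    -- otherwise the point of the generator VQ on plane s would lie on plane t as well
    chord-avoids-carrier : IsFlockOfCone Fl S → ∀ {s t} → s ≢ t →
      ∀ {Q} → S Q → dot3 (chord s t) (proj₁ Q) ≢ 0#
    chord-avoids-carrier onCone {s} {t} s≢t {Q , Q≢0} SQ chordQ≡0 =
      onCone s t s≢t (x , x≢0) ((Q , Q≢0) , SQ , a , 1# , x-on-VQ) (on-s , on-t)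
      where
        a : Carrier
        a = dot3 (coeff s) Q
        x : V4
        x 0F = Q 0F
        x 1F = Q 1F
        x 2F = Q 2F
        x 3F = a
        x≢0 : ¬ IsZero4 x
        x≢0 x≡0 = Q≢0 λ { 0F → x≡0 0F ; 1F → x≡0 1F ; 2F → x≡0 2F }
        x-on-VQ : ∀ i → x i ≡ lin a vertexV 1# (embed Q) i
        x-on-VQ 0F = solve 2 (λ a y → y := a :* :0 :+ :1 :* y) refl a (Q 0F)
        x-on-VQ 1F = solve 2 (λ a y → y := a :* :0 :+ :1 :* y) refl a (Q 1F)
        x-on-VQ 2F = solve 2 (λ a y → y := a :* :0 :+ :1 :* y) refl a (Q 2F)
        x-on-VQ 3F = solve 1 (λ a → a := a :* :1 :+ :1 :* :0) refl a
        on-s : OnPlane x (plane Fl s)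
        on-s = trans (plane-eval s x) (x≡y⇒x-y≡0 refl)
        on-t : OnPlane x (plane Fl t)
        on-t = trans (sym (x-y≡0⇒x≡y (trans (plane-chord s t x) chordQ≡0))) on-s

    Through : V4 → Carrier → Set
    Through w t = OnPlane w (plane Fl t)

    through-parallel : ∀ w {a a' c b} → SamePoint3 (chord a a') (chord c b) →
      Through w a → Through w a' → Through w c → Through w b
    through-parallel w {a} {a'} {c} {b} (λ′ , λ′≢0 , chord≡) wa wa' wc =
      sym (x-y≡0⇒x≡y (x*y≡0⇒y≡0 λ′≢0 (begin
        λ′ * (0# - φ b)                ≡⟨ cong (λ z → λ′ * (z - φ b)) wc ⟨
        λ′ * (φ c - φ b)               ≡⟨ cong (λ′ *_) (plane-chord c b w) ⟩
        λ′ * dot3 (chord c b) (toπ₀ w) ≡⟨ dot3-proportional (toπ₀ w) chord≡ ⟨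
        dot3 (chord a a') (toπ₀ w)     ≡⟨ plane-chord a a' w ⟨
        φ a - φ a'                     ≡⟨ x≡y⇒x-y≡0 (trans wa (sym wa')) ⟩
        0#                             ∎)))
      where
        φ : Carrier → Carrier
        φ t = dot4 (plane Fl t) w

    through-collinear : ∀ w {a a' b} → a ≢ a' → SamePoint3 (chord a b) (chord a' b) →
      Through w a → Through w a' → Through w b
    through-collinear w {a} {a'} {b} a≢a' (λ′ , _ , chord≡) wa wa' =
      x*y≡0⇒y≡0 1-λ′≢0 (begin
        (1# - λ′) * φ b
          ≡⟨ solve 2 (λ l y → (:1 :- l) :* y := l :* (:0 :- y) :- (:0 :- y)) refl λ′ (φ b) ⟩
        λ′ * (0# - φ b) - (0# - φ b)
          ≡⟨ cong₂ (λ u v → λ′ * (u - φ b) - (v - φ b)) wa' wa ⟨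
        λ′ * (φ a' - φ b) - (φ a - φ b)
          ≡⟨ cong₂ (λ u v → λ′ * u - v) (plane-chord a' b w) (plane-chord a b w) ⟩
        λ′ * dot3 (chord a' b) (toπ₀ w) - dot3 (chord a b) (toπ₀ w)
          ≡⟨ x≡y⇒x-y≡0 (sym (dot3-proportional (toπ₀ w) chord≡)) ⟩
        0#
          ∎)
      where
        φ : Carrier → Carrier
        φ t = dot4 (plane Fl t) w
        1-λ′≢0 : 1# - λ′ ≢ 0#
        1-λ′≢0 1-λ′≡0 = a≢a' (coeff-injective λ i → x-z≡y-z⇒x≡y (begin
          chord a b i          ≡⟨ chord≡ i ⟩
          λ′ * chord a' b i    ≡⟨ cong (_* chord a' b i) (x-y≡0⇒x≡y 1-λ′≡0) ⟨
          1# * chord a' b i    ≡⟨ solve 1 (λ y → :1 :* y := y) refl (chord a' b i) ⟩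
          chord a' b i         ∎))

    ThroughLine : Line → Carrier → Set
    ThroughLine ℓ t = Through (Line.u ℓ) t × Through (Line.v ℓ) t

    throughLine? : ∀ ℓ → Decidable (ThroughLine ℓ)
    throughLine? ℓ t with dot4 (plane Fl t) (Line.u ℓ) ≟ 0# | dot4 (plane Fl t) (Line.v ℓ) ≟ 0#
    ... | yes on-u | yes on-v = yes (on-u , on-v)
    ... | no ¬on-u | _        = no (¬on-u ∘ proj₁)
    ... | yes _    | no ¬on-v = no (¬on-v ∘ proj₂)

    -- Passing through a fixed point is an affine condition on the coefficient vector
    -- (plane-eval), so it propagates along these affine dependencies.
    record ChordClosed (P : Carrier → Set) : Set where
      field
        collinear : ∀ {a a' b} → a ≢ a' → SamePoint3 (chord a b) (chord a' b) → P a → P a' → P b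
        parallel  : ∀ {a a' c b} → SamePoint3 (chord a a') (chord c b) → P a → P a' → P c → P b

    throughLine-chordClosed : ∀ ℓ → ChordClosed (ThroughLine ℓ)
    throughLine-chordClosed ℓ = record
      { collinear = λ a≢a' same (ua , va) (ua' , va') →
          through-collinear (Line.u ℓ) a≢a' same ua ua' , through-collinear (Line.v ℓ) a≢a' same va va'
      ; parallel  = λ same (ua , va) (ua' , va') (uc , vc) →
          through-parallel (Line.u ℓ) same ua ua' uc , through-parallel (Line.v ℓ) same va va' vc
      }

    line-u≢0 : ∀ ℓ → ¬ IsZero4 (Line.u ℓ)
    line-u≢0 ℓ u≡0 = 0≢1 (sym (proj₁ (Line.indep ℓ 1# 0# λ i →
      trans (solve 2 (λ u v → :1 :* u :+ :0 :* v := u) refl (Line.u ℓ i) (Line.v ℓ i)) (u≡0 i))))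

    line-v≢0 : ∀ ℓ → ¬ IsZero4 (Line.v ℓ)
    line-v≢0 ℓ v≡0 = 0≢1 (sym (proj₂ (Line.indep ℓ 0# 1# λ i →
      trans (solve 2 (λ u v → :0 :* u :+ :1 :* v := v) refl (Line.u ℓ i) (Line.v ℓ i)) (v≡0 i))))

    contains⇒throughLine : ∀ {ℓ t} → PlaneContains (plane Fl t) ℓ → ThroughLine ℓ t
    contains⇒throughLine {ℓ} contains =
        contains (Line.u ℓ , line-u≢0 ℓ)
          (1# , 0# , λ i → solve 2 (λ u v → u := :1 :* u :+ :0 :* v) refl (Line.u ℓ i) (Line.v ℓ i))
      , contains (Line.v ℓ , line-v≢0 ℓ)
          (0# , 1# , λ i → solve 2 (λ u v → v := :0 :* u :+ :1 :* v) refl (Line.u ℓ i) (Line.v ℓ i))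

    embed≢0 : ∀ {y} → ¬ IsZero3 y → ¬ IsZero4 (embed y)
    embed≢0 y≢0 embed≡0 = y≢0 λ { 0F → embed≡0 0F ; 1F → embed≡0 1F ; 2F → embed≡0 2F }

    coeffs-multiplesOf : ∀ {a a'} → 0# ≡ a → (∀ t → t ≡ a ⊎ t ≡ a') →
      ∀ t → ∃ λ c → ∀ i → coeff t i ≡ c * coeff a' i
    coeffs-multiplesOf {a' = a'} 0≡a a∪a' t with a∪a' t
    ... | inj₁ refl = 0# , λ i →
      trans (cong (λ s → coeff s i) (sym 0≡a)) (trans (coeff-0 i) (sym (*-zeroˡ (coeff a' i))))
    ... | inj₂ refl = 1# , λ i → solve 1 (λ y → y := :1 :* y) refl (coeff a' i)

    module ProperStar (star : IsProperStar Fl) where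
      centre : V4
      centre = proj₁ (proj₁ (proj₁ star))

      centre-common : ∀ t → Through centre t
      centre-common = proj₂ (proj₁ star)

      centre-unique : ∀ X Y → CommonPoint Fl X → CommonPoint Fl Y → SamePoint (proj₁ X) (proj₁ Y)
      centre-unique = proj₂ star

      centre₃≡0 : centre 3F ≡ 0#
      centre₃≡0 = -x≡0⇒x≡0 (begin
        - centre 3F                                    ≡⟨ solve 1 (λ x → :- x := :0 :- x) refl (centre 3F) ⟩
        0# - centre 3F                                 ≡⟨ cong (_- centre 3F) coeff-0⊥ ⟨
        dot3 (coeff 0#) (toπ₀ centre) - centre 3F      ≡⟨ plane-eval 0# centre ⟨
        dot4 (plane Fl 0#) centre                      ≡⟨ centre-common 0# ⟩
        0#                                             ∎)
        where
          coeff-0⊥ : dot3 (coeff 0#) (toπ₀ centre) ≡ 0#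
          coeff-0⊥ = trans (dot3-proportional {c = 0#} (toπ₀ centre) λ i → trans (coeff-0 i) (sym (*-zeroˡ (coeff 0# i))))
                           (*-zeroˡ _)

      p₀ : V3
      p₀ = toπ₀ centre

      p₀≢0 : ¬ IsZero3 p₀
      p₀≢0 p₀≡0 = proj₂ (proj₁ (proj₁ star))
        λ { 0F → p₀≡0 0F ; 1F → p₀≡0 1F ; 2F → p₀≡0 2F ; 3F → centre₃≡0 }

      chord-incident : ∀ s t → dot3 (chord s t) p₀ ≡ 0#
      chord-incident s t =
        trans (sym (plane-chord s t centre)) (x≡y⇒x-y≡0 (trans (centre-common s) (sym (centre-common t))))

      coeffs-not-collinear : ∀ w → ¬ (∀ t → ∃ λ c → ∀ i → coeff t i ≡ c * w i)
      coeffs-not-collinear w collinear =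
        different (restrict (centre-unique (embed y , embed≢0 y≢0) (embed y' , embed≢0 y'≢0)
                                           (common {y} on) (common {y'} on')))
        where
          open TwoPointsOn (twoPointsOn w)
          common : ∀ {z} → dot3 w z ≡ 0# → ∀ t → Through (embed z) t
          common {z} wz≡0 t with collinear t
          ... | c , coeff≡cw = begin
            dot4 (plane Fl t) (embed z)    ≡⟨ plane-eval t (embed z) ⟩
            dot3 (coeff t) z - 0#          ≡⟨ cong (_- 0#) (dot3-proportional z coeff≡cw) ⟩
            c * dot3 w z - 0#              ≡⟨ cong (λ x → c * x - 0#) wz≡0 ⟩
            c * 0# - 0#                    ≡⟨ solve 1 (λ c → c :* :0 :- :0 := :0) refl c ⟩
            0#                             ∎
          restrict : SamePoint (embed y) (embed y') → SamePoint3 y y'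
          restrict (c , c≢0 , e) = c , c≢0 , λ { 0F → e 0F ; 1F → e 1F ; 2F → e 2F }

      at-least-three-planes : ∀ {a a'} → ¬ (∀ t → t ≡ a ⊎ t ≡ a')
      at-least-three-planes {a} {a'} a∪a' with a∪a' 0#
      ... | inj₁ 0≡a  = coeffs-not-collinear (coeff a') (coeffs-multiplesOf 0≡a a∪a')
      ... | inj₂ 0≡a' = coeffs-not-collinear (coeff a) (coeffs-multiplesOf 0≡a' (swap ∘ a∪a'))

      no-line-in-all-planes : ∀ ℓ → ¬ (∀ t → ThroughLine ℓ t)
      no-line-in-all-planes ℓ all
        with centre-unique (Line.u ℓ , line-u≢0 ℓ) (Line.v ℓ , line-v≢0 ℓ) (proj₁ ∘ all) (proj₂ ∘ all)
      ... | c , _ , u≡cv = 0≢1 (sym (proj₁ (Line.indep ℓ 1# (- c) λ i → begin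
        1# * Line.u ℓ i + - c * Line.v ℓ i         ≡⟨ cong (λ x → 1# * x + - c * Line.v ℓ i) (u≡cv i) ⟩
        1# * (c * Line.v ℓ i) + - c * Line.v ℓ i   ≡⟨ solve 2 (λ c v → :1 :* (c :* v) :+ (:- c) :* v := :0)
                                                             refl c (Line.v ℓ i) ⟩
        0#                                         ∎)))

      module ChordFamily {P : Carrier → Set} (closed : ChordClosed P)
                         {a₁ a₂ rest b} (As-unique : Unique (a₁ ∷ a₂ ∷ rest))
                         (As⊆P : All P (a₁ ∷ a₂ ∷ rest)) (¬Pb : ¬ P b) where
        open ChordClosed closed

        As : List Carrier
        As = a₁ ∷ a₂ ∷ rest

        a : Fin (length As) → Carrier
        a = lookup As

        Pa : ∀ i → P (a i)
        Pa i = All.lookup As⊆P (∈-lookup i)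

        source target : Fin (suc (length As)) → Carrier
        source zero    = a₁
        source (suc i) = a i
        target zero    = a₂
        target (suc i) = b

        source≢target : ∀ j → source j ≢ target j
        source≢target zero    = All.head (AllPairs.head As-unique)
        source≢target (suc i) aᵢ≡b = ¬Pb (subst P aᵢ≡b (Pa i))

        chords : Fin (suc (length As)) → V3
        chords j = chord (source j) (target j)

        chords-distinct : Injective _≡_ SamePoint3 chords
        chords-distinct {zero}  {zero}  _    = refl
        chords-distinct {zero}  {suc i} same = ⊥-elim (¬Pb (parallel same (Pa 0F) (Pa 1F) (Pa i)))
        chords-distinct {suc i} {zero}  same = ⊥-elim (¬Pb (parallel (SamePoint3-sym same) (Pa 0F) (Pa 1F) (Pa i)))
        chords-distinct {suc i} {suc j} same with a i ≟ a j
        ... | yes aᵢ≡aⱼ = cong suc (lookup-injective As-unique i j aᵢ≡aⱼ)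
        ... | no aᵢ≢aⱼ  = ⊥-elim (¬Pb (collinear aᵢ≢aⱼ same (Pa i) (Pa j)))

        chords-lines : LinesThrough p₀ chords
        chords-lines = record
          { nonzero  = chord-≢0 ∘ source≢target
          ; incident = λ j → chord-incident (source j) (target j)
          ; distinct = chords-distinct
          }

      width+chords≤q+1 : IsFlockOfCone Fl S → ∀ {K} → WidthAtLeastAt S (p₀ , p₀≢0) K →
        ∀ {P} → ChordClosed P →
        ∀ {a₁ a₂ rest b} → Unique (a₁ ∷ a₂ ∷ rest) → All P (a₁ ∷ a₂ ∷ rest) → ¬ P b →
        K ℕ.+ suc (length (a₁ ∷ a₂ ∷ rest)) ℕ.≤ suc q
      width+chords≤q+1 onCone (lines , on-lines , lines-distinct) closed As-unique As⊆P ¬Pb =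
        linesThrough-≤ p₀≢0 (linesThrough-++ width-lines chords-lines apart)
        where
          open ChordFamily closed As-unique As⊆P ¬Pb
          width-lines : LinesThrough p₀ (proj₁ ∘ lines)
          width-lines = record
            { nonzero  = proj₂ ∘ lines
            ; incident = proj₁ ∘ on-lines
            ; distinct = lines-distinct _ _
            }
          apart : ∀ i j → ¬ SamePoint3 (proj₁ (lines i)) (chords j)
          apart i j same with proj₂ (on-lines i)
          ... | Q , SQ , Q-on = chord-avoids-carrier onCone (source≢target j) SQ
                                  (SamePoint3-dot3≡0 (proj₁ Q) (SamePoint3-sym same) Q-on)

      planesThrough : Line → List Carrier
      planesThrough ℓ = filter (throughLine? ℓ) elements

      module _ (onCone : IsFlockOfCone Fl S) (wide : Wide S) (ℓ m : Line)
               (cover : ∀ t → ThroughLine ℓ t ⊎ ThroughLine m t) where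

        covering-impossible : (As Bs : List Carrier) → Unique As → All (ThroughLine ℓ) As →
          (∀ {t} → ThroughLine ℓ t → t ∈ As) → (∀ {t} → ThroughLine m t → t ∈ Bs) →
          ∃ (¬_ ∘ ThroughLine ℓ) → q ℕ.≤ length As ℕ.+ length Bs → length Bs ℕ.≤ length As → ⊥
        covering-impossible [] Bs _ _ _ _ _ q≤ Bs≤ = ℕ.<⇒≱ 2≤q (ℕ.≤-trans q≤ (ℕ.≤-trans Bs≤ z≤n))
        covering-impossible (_ ∷ []) [] _ _ _ _ _ q≤ _ = ℕ.<⇒≱ 2≤q q≤
        covering-impossible (_ ∷ []) (_ ∷ []) _ _ ℓ⊆ m⊆ _ _ _ =
          at-least-three-planes λ t → Sum.map (single ∘ ℓ⊆) (single ∘ m⊆) (cover t)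
          where
            single : ∀ {x y} → x ∈ y ∷ [] → x ≡ y
            single (here x≡y) = x≡y
        covering-impossible (_ ∷ []) (_ ∷ _ ∷ _) _ _ _ _ _ _ (s≤s ())
        covering-impossible As@(_ ∷ _ ∷ _) Bs As-unique As⊆ℓ _ _ (b , ¬ℓb) q≤ Bs≤ =
          ℕ.<⇒≱ (width+chords>q+1 q (length As) (ℕ.≤-trans q≤ (ℕ.+-monoʳ-≤ (length As) Bs≤)))
                (width+chords≤q+1 onCone (wide (p₀ , p₀≢0)) (throughLine-chordClosed ℓ) As-unique As⊆ℓ ¬ℓb)

        bilinear-impossible : length (planesThrough m) ℕ.≤ length (planesThrough ℓ) → ⊥
        bilinear-impossible =
          covering-impossible (planesThrough ℓ) (planesThrough m)
            (Unique.filter⁺ (throughLine? ℓ) elements-unique)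
            (All.tabulate (proj₂ ∘ ∈-filter⁻ (throughLine? ℓ) {xs = elements}))
            (∈-filter⁺ (throughLine? ℓ) (∈-elements _))
            (∈-filter⁺ (throughLine? m) (∈-elements _))
            (¬∀⇒∃¬ (throughLine? ℓ) (no-line-in-all-planes ℓ))
            (subst (ℕ._≤ length (planesThrough ℓ) ℕ.+ length (planesThrough m)) length-elements
              (length-≤-filter-+-filter (throughLine? ℓ) (throughLine? m) cover elements))

theorem5p1 : (F : FiniteField) → let open Geometry F in
    (S : PointSet) → Nonempty S → Wide S →
    (Fl : Flock) → IsFlockOfCone Fl S → IsBilinear Fl → IsProperStar Fl → ⊥
theorem5p1 F S _ wide Fl onCone (ℓ , m , _ , contains) star =
  [ bilinear-impossible onCone wide ℓ m cover
  , bilinear-impossible onCone wide m ℓ (swap ∘ cover)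
  ]′ (ℕ.≤-total (length (planesThrough m)) (length (planesThrough ℓ)))
  where
    open Flocks F
    open FlockGeometry S Fl
    open ProperStar star
    cover : ∀ t → ThroughLine ℓ t ⊎ ThroughLine m t
    cover t = Sum.map (contains⇒throughLine {ℓ} {t}) (contains⇒throughLine {m} {t}) (contains t)
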